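{- Every cycle spider is strongly antimagic.
   Context: A spider is a tree with exactly one vertex $u$ (the center) of degree at least $3$; it is the union of $\deg(u)\geqslant 3$ paths (legs) sharing only the endpoint $u$. A cycle spider is obtained by replacing each leg of a spider by a cycle, i.e. it is a graph consisting of at least three cycles (each of length at least $3$) which pairwise share exactly one common vertex $u$ and are otherwise vertex-disjoint. For a graph with $m$ edges, a strongly antimagic labeling is a bijection $f:E\to\{1,\ldots,m\}$ such that the vertex sums $\phi_f(x)=\sum_{e\ni x}f(e)$ are pairwise distinct and $\phi_f(x)>\phi_f(y)$ whenever $\deg(x)>\deg(y)$; a graph is strongly antimagic if it admits one. -}

module Defs where

open import Data.Nat using (ℕ; zero; suc; _+_; _∸_; _<_; _≟_)
open import Data.Fin using (Fin; toℕ)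
open import Data.List using (List; []; _∷_; _++_; [_]; length; lookup; map; allFin)
open import Data.Nat.ListAction using (sum)
open import Data.Product using (_×_; _,_; proj₁; proj₂; Σ-syntax)
open import Data.Bool using (Bool; true; false; _∨_; if_then_else_)
open import Relation.Nullary.Decidable using (⌊_⌋)
open import Relation.Binary.PropositionalEquality using (_≡_; _≢_)
open import Function.Definitions using (Bijective)

-- A finite (multi)graph: vertex set Fin n, edges given as a list of
-- pairs of vertex numbers (every endpoint is < n by construction below).
record Graph : Set where
  constructor mkGraph
  field
    n     : ℕ
    edges : List (ℕ × ℕ)

open Graph public

m : Graph → ℕ
m G = length (edges G)

incident : ℕ → ℕ × ℕ → Bool
incident x (a , b) = ⌊ x ≟ a ⌋ ∨ ⌊ x ≟ b ⌋

edge : (G : Graph) → Fin (m G) → ℕ × ℕ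
edge G i = lookup (edges G) i

deg : (G : Graph) → Fin (n G) → ℕ
deg G x = sum (map (λ i → if incident (toℕ x) (edge G i) then 1 else 0) (allFin (m G)))

-- A labeling is a bijection f : E → {1,…,m}; we encode it as a bijection
-- f : Fin m → Fin m, edge number i receiving label 1 + toℕ (f i).
label : (G : Graph) → (Fin (m G) → Fin (m G)) → Fin (m G) → ℕ
label G f i = suc (toℕ (f i))

φ : (G : Graph) → (Fin (m G) → Fin (m G)) → Fin (n G) → ℕ
φ G f x = sum (map (λ i → if incident (toℕ x) (edge G i) then label G f i else 0) (allFin (m G)))

StronglyAntimagic : Graph → Set
StronglyAntimagic G =
  Σ[ f ∈ (Fin (m G) → Fin (m G)) ]
    ( Bijective _≡_ _≡_ f
    × (∀ x y → x ≢ y → φ G f x ≢ φ G f y)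
    × (∀ x y → deg G y < deg G x → φ G f y < φ G f x))

-- Cycle spider.  Vertex 0 is the center u.  A cycle of length L whose
-- non-center vertices are o, o+1, …, o+L-2 has edges
--   u–o, o–(o+1), …, (o+L-3)–(o+L-2), (o+L-2)–u.
pathEdges : ℕ → ℕ → List (ℕ × ℕ)
pathEdges o zero    = []
pathEdges o (suc t) = (o , suc o) ∷ pathEdges (suc o) t

cycleEdges : ℕ → ℕ → List (ℕ × ℕ)
cycleEdges o L = ((0 , o) ∷ pathEdges o (L ∸ 2)) ++ [ (o + (L ∸ 2) , 0) ]

spiderEdges : ℕ → List ℕ → List (ℕ × ℕ)
spiderEdges o []       = []
spiderEdges o (L ∷ Ls) = cycleEdges o L ++ spiderEdges (o + (L ∸ 1)) Ls

cycleSpider : List ℕ → Graph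
cycleSpider Ls = mkGraph (suc (sum (map (λ L → L ∸ 1) Ls))) (spiderEdges 1 Ls)

{-# OPTIONS --safe #-}
module Submission where

-- Number the m edges in the order of spiderEdges: every cycle is traversed from the centre and
-- back, so each non-central vertex lies on exactly two consecutive edges j, j + 1, and j
-- increases with the vertex. Label edge j by 1 + zigzag ⌊m/2⌋ j, where ⌊m/2⌋, 0, ⌊m/2⌋ + 1, 1, …
-- is a permutation of 0, …, m − 1 whose consecutive terms sum to ⌊m/2⌋ + j. The non-central
-- vertex sums ⌊m/2⌋ + j + 2 are then distinct and at most ⌊m/2⌋ + m ≤ 3⌊m/2⌋ + 1, whereas the
-- centre meets edge 0 (label ⌊m/2⌋ + 1) and two further consecutive pairs (the last edge of a
-- cycle and the first edge of the next), so its sum is at least 3⌊m/2⌋ + 5. Non-central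
-- vertices have degree 2, so this also settles the degree condition.

open import Defs
open import Data.Nat using (ℕ; zero; suc; _+_; _∸_; _≤_; _<_; _≟_; _<?_; ⌊_/2⌋; ⌈_/2⌉; z≤n; s≤s; s≤s⁻¹; z<s)
open import Data.Nat.Properties
open import Data.Nat.ListAction using (sum)
open import Data.Nat.Tactic.RingSolver using (solve-∀)
open import Data.Fin using (Fin; toℕ; fromℕ<) renaming (zero to fzero; suc to fsuc)
import Data.Fin as Fin
import Data.Fin.Properties as Fin
open import Data.List using (List; []; _∷_; _++_; [_]; length; lookup; map; tabulate; allFin)
open import Data.List.Properties using (map-tabulate; tabulate-cong; length-++)
open import Data.List.Relation.Unary.All as All using (All; []; _∷_)
open import Data.Bool using (true; false; if_then_else_)
open import Data.Product using (_×_; _,_; ∃₂; ∃-syntax)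
open import Data.Sum using (_⊎_; inj₁; inj₂)
open import Function using (_∘′_)
open import Function.Definitions using (Bijective; Injective)
open import Function.Consequences.Propositional using (strictlySurjective⇒surjective)
open import Relation.Binary using (tri<; tri≈; tri>)
open import Relation.Binary.PropositionalEquality hiding ([_])
open import Relation.Nullary using (yes; no; contradiction)

data Parity : ℕ → Set where
  even : ∀ a → Parity (a + a)
  odd  : ∀ a → Parity (suc (a + a))

+-suc-suc : ∀ m n → m + suc (suc n) ≡ suc (suc (m + n))
+-suc-suc m n = trans (+-suc m (suc n)) (cong suc (+-suc m n))

1+a+1+a≡2+a+a : ∀ a → suc a + suc a ≡ suc (suc (a + a))
1+a+1+a≡2+a+a a = cong suc (+-suc a a)

parity : ∀ n → Parity n
parity zero = even 0
parity (suc zero) = odd 0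
parity (suc (suc n)) with parity n
... | even a = subst Parity (1+a+1+a≡2+a+a a) (even (suc a))
... | odd a  = subst Parity (cong suc (1+a+1+a≡2+a+a a)) (odd (suc a))

zigzag : ℕ → ℕ → ℕ
zigzag h zero          = h
zigzag h (suc zero)    = zero
zigzag h (suc (suc j)) = suc (zigzag h j)

zigzag-even : ∀ h a → zigzag h (a + a) ≡ h + a
zigzag-even h zero    = sym (+-identityʳ h)
zigzag-even h (suc a) rewrite 1+a+1+a≡2+a+a a =
  trans (cong suc (zigzag-even h a)) (sym (+-suc h a))

zigzag-odd : ∀ h a → zigzag h (suc (a + a)) ≡ a
zigzag-odd h zero    = refl
zigzag-odd h (suc a) rewrite +-suc a a = cong suc (zigzag-odd h a)

zigzag-consecutive : ∀ h j → zigzag h j + zigzag h (suc j) ≡ h + j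
zigzag-consecutive h zero          = refl
zigzag-consecutive h (suc zero)    = sym (+-comm h 1)
zigzag-consecutive h (suc (suc j)) = begin
  suc (zigzag h j) + suc (zigzag h (suc j)) ≡⟨ cong suc (+-suc (zigzag h j) _) ⟩
  suc (suc (zigzag h j + zigzag h (suc j))) ≡⟨ cong (suc ∘′ suc) (zigzag-consecutive h j) ⟩
  suc (suc (h + j))                         ≡⟨ +-suc-suc h j ⟨
  h + suc (suc j)                           ∎
  where open ≡-Reasoning

⌈n/2⌉≤1+⌊n/2⌋ : ∀ n → ⌈ n /2⌉ ≤ suc ⌊ n /2⌋
⌈n/2⌉≤1+⌊n/2⌋ zero          = z≤n
⌈n/2⌉≤1+⌊n/2⌋ (suc zero)    = s≤s z≤n
⌈n/2⌉≤1+⌊n/2⌋ (suc (suc n)) = s≤s (⌈n/2⌉≤1+⌊n/2⌋ n)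

⌊n/2⌋+⌊n/2⌋≤n : ∀ n → ⌊ n /2⌋ + ⌊ n /2⌋ ≤ n
⌊n/2⌋+⌊n/2⌋≤n n = ≤-trans (+-monoʳ-≤ ⌊ n /2⌋ (⌊n/2⌋≤⌈n/2⌉ n)) (≤-reflexive (⌊n/2⌋+⌈n/2⌉≡n n))

n≤⌈n/2⌉+⌈n/2⌉ : ∀ n → n ≤ ⌈ n /2⌉ + ⌈ n /2⌉
n≤⌈n/2⌉+⌈n/2⌉ n = ≤-trans (≤-reflexive (sym (⌊n/2⌋+⌈n/2⌉≡n n))) (+-monoˡ-≤ ⌈ n /2⌉ (⌊n/2⌋≤⌈n/2⌉ n))

n≤1+⌊n/2⌋+⌊n/2⌋ : ∀ n → n ≤ suc (⌊ n /2⌋ + ⌊ n /2⌋)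
n≤1+⌊n/2⌋+⌊n/2⌋ n = begin
  n                       ≡⟨ ⌊n/2⌋+⌈n/2⌉≡n n ⟨
  ⌊ n /2⌋ + ⌈ n /2⌉       ≤⟨ +-monoʳ-≤ ⌊ n /2⌋ (⌈n/2⌉≤1+⌊n/2⌋ n) ⟩
  ⌊ n /2⌋ + suc ⌊ n /2⌋   ≡⟨ +-suc ⌊ n /2⌋ ⌊ n /2⌋ ⟩
  suc (⌊ n /2⌋ + ⌊ n /2⌋) ∎
  where open ≤-Reasoning

a+a<n⇒⌊n/2⌋+a<n : ∀ {a n} → a + a < n → ⌊ n /2⌋ + a < n
a+a<n⇒⌊n/2⌋+a<n {a} {n} a+a<n = subst (⌊ n /2⌋ + a <_) (⌊n/2⌋+⌈n/2⌉≡n n) (+-monoʳ-< ⌊ n /2⌋ a<⌈n/2⌉)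
  where
  a<⌈n/2⌉ : a < ⌈ n /2⌉
  a<⌈n/2⌉ = ≰⇒> λ c≤a → <⇒≱ a+a<n (≤-trans (n≤⌈n/2⌉+⌈n/2⌉ n) (+-mono-≤ c≤a c≤a))

⌊n/2⌋+a<n⇒a+a<n : ∀ {a n} → ⌊ n /2⌋ + a < n → a + a < n
⌊n/2⌋+a<n⇒a+a<n {a} {n} h+a<n = ≤-<-trans (+-monoˡ-≤ a a≤⌊n/2⌋) h+a<n
  where
  a≤⌊n/2⌋ : a ≤ ⌊ n /2⌋
  a≤⌊n/2⌋ = +-cancelˡ-≤ ⌊ n /2⌋ a ⌊ n /2⌋ (s≤s⁻¹ (≤-trans h+a<n (n≤1+⌊n/2⌋+⌊n/2⌋ n)))

1+a+a<n⇒a<⌊n/2⌋ : ∀ {a n} → suc (a + a) < n → a < ⌊ n /2⌋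
1+a+a<n⇒a<⌊n/2⌋ {a} {n} lt = ≰⇒> λ h≤a → <⇒≱ lt (≤-trans (n≤1+⌊n/2⌋+⌊n/2⌋ n) (s≤s (+-mono-≤ h≤a h≤a)))

a<⌊n/2⌋⇒1+a+a<n : ∀ {a n} → a < ⌊ n /2⌋ → suc (a + a) < n
a<⌊n/2⌋⇒1+a+a<n {a} {n} a<h =
  subst (_≤ n) (1+a+1+a≡2+a+a a) (≤-trans (+-mono-≤ a<h a<h) (⌊n/2⌋+⌊n/2⌋≤n n))

zigzag-< : ∀ {n j} → j < n → zigzag ⌊ n /2⌋ j < n
zigzag-< {n} {j} j<n with parity j
... | even a rewrite zigzag-even ⌊ n /2⌋ a = a+a<n⇒⌊n/2⌋+a<n j<n
... | odd a  rewrite zigzag-odd ⌊ n /2⌋ a  = <-trans (s≤s (m≤m+n a a)) j<n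

zigzag-injective : ∀ {n j k} → j < n → k < n → zigzag ⌊ n /2⌋ j ≡ zigzag ⌊ n /2⌋ k → j ≡ k
zigzag-injective {n} {j} {k} j<n k<n eq with parity j | parity k
... | even a | even b rewrite zigzag-even ⌊ n /2⌋ a | zigzag-even ⌊ n /2⌋ b =
  cong (λ c → c + c) (+-cancelˡ-≡ ⌊ n /2⌋ a b eq)
... | odd a  | odd b  rewrite zigzag-odd ⌊ n /2⌋ a | zigzag-odd ⌊ n /2⌋ b =
  cong (λ c → suc (c + c)) eq
... | even a | odd b  rewrite zigzag-even ⌊ n /2⌋ a | zigzag-odd ⌊ n /2⌋ b =
  contradiction (subst (⌊ n /2⌋ ≤_) eq (m≤m+n ⌊ n /2⌋ a)) (<⇒≱ (1+a+a<n⇒a<⌊n/2⌋ k<n))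
... | odd a  | even b rewrite zigzag-odd ⌊ n /2⌋ a | zigzag-even ⌊ n /2⌋ b =
  contradiction (subst (⌊ n /2⌋ ≤_) (sym eq) (m≤m+n ⌊ n /2⌋ b)) (<⇒≱ (1+a+a<n⇒a<⌊n/2⌋ j<n))

zigzag-surjective : ∀ {n v} → v < n → ∃[ j ] j < n × zigzag ⌊ n /2⌋ j ≡ v
zigzag-surjective {n} {v} v<n with v <? ⌊ n /2⌋
... | yes v<h = suc (v + v) , a<⌊n/2⌋⇒1+a+a<n v<h , zigzag-odd ⌊ n /2⌋ v
... | no v≮h  = a + a , ⌊n/2⌋+a<n⇒a+a<n (subst (_< n) (sym h+a≡v) v<n) ,
                trans (zigzag-even ⌊ n /2⌋ a) h+a≡v
  where
  a = v ∸ ⌊ n /2⌋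
  h+a≡v : ⌊ n /2⌋ + a ≡ v
  h+a≡v = m+[n∸m]≡n (≮⇒≥ v≮h)

zigzagFin : ∀ n → Fin n → Fin n
zigzagFin n i = fromℕ< (zigzag-< (Fin.toℕ<n i))

toℕ-zigzagFin : ∀ n i → toℕ (zigzagFin n i) ≡ zigzag ⌊ n /2⌋ (toℕ i)
toℕ-zigzagFin n i = Fin.toℕ-fromℕ< (zigzag-< (Fin.toℕ<n i))

zigzagFin-bijective : ∀ n → Bijective _≡_ _≡_ (zigzagFin n)
zigzagFin-bijective n = injective , strictlySurjective⇒surjective strictlySurjective
  where
  injective : Injective _≡_ _≡_ (zigzagFin n)
  injective {i} {j} eq = Fin.toℕ-injective (zigzag-injective (Fin.toℕ<n i) (Fin.toℕ<n j)
    (trans (sym (toℕ-zigzagFin n i)) (trans (cong toℕ eq) (toℕ-zigzagFin n j))))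
  strictlySurjective : ∀ v → ∃[ i ] zigzagFin n i ≡ v
  strictlySurjective v with zigzag-surjective (Fin.toℕ<n v)
  ... | j , j<n , eq = fromℕ< j<n , Fin.toℕ-injective (begin
    toℕ (zigzagFin n (fromℕ< j<n))        ≡⟨ toℕ-zigzagFin n (fromℕ< j<n) ⟩
    zigzag ⌊ n /2⌋ (toℕ (fromℕ< j<n))     ≡⟨ cong (zigzag ⌊ n /2⌋) (Fin.toℕ-fromℕ< j<n) ⟩
    zigzag ⌊ n /2⌋ j                       ≡⟨ eq ⟩
    toℕ v                                  ∎)
    where open ≡-Reasoning

incidenceSum : ℕ → (ℕ → ℕ) → ℕ → List (ℕ × ℕ) → ℕ
incidenceSum x w k []       = 0
incidenceSum x w k (e ∷ es) = (if incident x e then w k else 0) + incidenceSum x w (suc k) es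

incidenceSum-++ : ∀ x w k as bs →
  incidenceSum x w k (as ++ bs) ≡ incidenceSum x w k as + incidenceSum x w (k + length as) bs
incidenceSum-++ x w k []       bs = cong (λ k′ → incidenceSum x w k′ bs) (sym (+-identityʳ k))
incidenceSum-++ x w k (e ∷ as) bs = begin
  wₑ + incidenceSum x w (suc k) (as ++ bs)
    ≡⟨ cong (wₑ +_) (incidenceSum-++ x w (suc k) as bs) ⟩
  wₑ + (incidenceSum x w (suc k) as + incidenceSum x w (suc k + length as) bs)
    ≡⟨ cong (λ k′ → wₑ + (incidenceSum x w (suc k) as + incidenceSum x w k′ bs)) (sym (+-suc k (length as))) ⟩
  wₑ + (incidenceSum x w (suc k) as + incidenceSum x w (k + suc (length as)) bs)
    ≡⟨ sym (+-assoc wₑ _ _) ⟩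
  wₑ + incidenceSum x w (suc k) as + incidenceSum x w (k + suc (length as)) bs ∎
  where
  wₑ = if incident x e then w k else 0
  open ≡-Reasoning

incidenceSum-tabulate : ∀ x w k es →
  sum (tabulate {n = length es} (λ i → if incident x (lookup es i) then w (k + toℕ i) else 0))
    ≡ incidenceSum x w k es
incidenceSum-tabulate x w k []       = refl
incidenceSum-tabulate x w k (e ∷ es) = cong₂ _+_
  (cong (λ k′ → if incident x e then w k′ else 0) (+-identityʳ k))
  (trans (cong sum (tabulate-cong λ i → cong (λ k′ → if incident x (lookup es i) then w k′ else 0) (+-suc k (toℕ i))))
         (incidenceSum-tabulate x w (suc k) es))

incidenceSum-allFin : ∀ x es (u : Fin (length es) → ℕ) (w : ℕ → ℕ) → (∀ i → u i ≡ w (toℕ i)) →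
  sum (map (λ i → if incident x (lookup es i) then u i else 0) (allFin (length es)))
    ≡ incidenceSum x w 0 es
incidenceSum-allFin x es u w u≗w = begin
  sum (map (term u) (allFin (length es)))  ≡⟨ cong sum (map-tabulate (λ i → i) (term u)) ⟩
  sum (tabulate (term u))                  ≡⟨ cong sum (tabulate-cong λ i →
                                                cong (λ v → if incident x (lookup es i) then v else 0) (u≗w i)) ⟩
  sum (tabulate (term (w ∘′ toℕ)))         ≡⟨ incidenceSum-tabulate x w 0 es ⟩
  incidenceSum x w 0 es                    ∎
  where
  term : (Fin (length es) → ℕ) → Fin (length es) → ℕ
  term v i = if incident x (lookup es i) then v i else 0
  open ≡-Reasoning

incident-fst : ∀ x b → incident x (x , b) ≡ true
incident-fst x b with x ≟ x
... | yes _   = refl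
... | no x≢x = contradiction refl x≢x

incident-snd : ∀ x a → incident x (a , x) ≡ true
incident-snd x a with x ≟ a | x ≟ x
... | yes _ | _       = refl
... | no _  | yes _   = refl
... | no _  | no x≢x = contradiction refl x≢x

incident-none : ∀ {x a b} → x ≢ a → x ≢ b → incident x (a , b) ≡ false
incident-none {x} {a} {b} x≢a x≢b with x ≟ a | x ≟ b
... | yes x≡a | _       = contradiction x≡a x≢a
... | no _    | yes x≡b = contradiction x≡b x≢b
... | no _    | no _    = refl

incidenceSum-∷-fst : ∀ x b w k es → incidenceSum x w k ((x , b) ∷ es) ≡ w k + incidenceSum x w (suc k) es
incidenceSum-∷-fst x b w k es rewrite incident-fst x b = refl

incidenceSum-∷-snd : ∀ x a w k es → incidenceSum x w k ((a , x) ∷ es) ≡ w k + incidenceSum x w (suc k) es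
incidenceSum-∷-snd x a w k es rewrite incident-snd x a = refl

incidenceSum-∷-none : ∀ {x a b} w k es → x ≢ a → x ≢ b →
  incidenceSum x w k ((a , b) ∷ es) ≡ incidenceSum x w (suc k) es
incidenceSum-∷-none w k es x≢a x≢b rewrite incident-none x≢a x≢b = refl

path : ℕ → ℕ → ℕ → List (ℕ × ℕ)
path o zero    b = [ (o , b) ]
path o (suc t) b = (o , suc o) ∷ path (suc o) t b

length-path : ∀ o t b → length (path o t b) ≡ suc t
length-path o zero    b = refl
length-path o (suc t) b = cong suc (length-path (suc o) t b)

Outside : ℕ → ℕ → ℕ → Set
Outside o t x = x < o ⊎ o + t < x

Outside⇒≢ : ∀ {o t x} → Outside o t x → x ≢ o
Outside⇒≢ (inj₁ x<o)   = <⇒≢ x<o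
Outside⇒≢ {o} {t} (inj₂ o+t<x) = ≢-sym (<⇒≢ (≤-<-trans (m≤m+n o t) o+t<x))

Outside-suc : ∀ {o t x} → Outside o (suc t) x → Outside (suc o) t x
Outside-suc (inj₁ x<o)    = inj₁ (m<n⇒m<1+n x<o)
Outside-suc {o} {t} {x} (inj₂ o+1+t<x) = inj₂ (subst (_< x) (+-suc o t) o+1+t<x)

path-avoid : ∀ {x} o t b w k → x ≢ b → Outside o t x → incidenceSum x w k (path o t b) ≡ 0
path-avoid o zero    b w k x≢b x∉ = incidenceSum-∷-none w k [] (Outside⇒≢ x∉) x≢b
path-avoid o (suc t) b w k x≢b x∉ =
  trans (incidenceSum-∷-none w k (path (suc o) t b) (Outside⇒≢ x∉) (Outside⇒≢ (Outside-suc x∉)))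
        (path-avoid (suc o) t b w (suc k) x≢b (Outside-suc x∉))

path-start : ∀ o t b w k → o ≢ b → incidenceSum o w k (path o t b) ≡ w k
path-start o zero    b w k o≢b = trans (incidenceSum-∷-fst o b w k []) (+-identityʳ (w k))
path-start o (suc t) b w k o≢b = trans (incidenceSum-∷-fst o (suc o) w k (path (suc o) t b))
  (trans (cong (w k +_) (path-avoid (suc o) t b w (suc k) o≢b (inj₁ (n<1+n o)))) (+-identityʳ (w k)))

path-end : ∀ {x} o t w k → x < o → incidenceSum x w k (path o t x) ≡ w (k + t)
path-end {x} o zero    w k x<o = trans (incidenceSum-∷-snd x o w k [])
  (trans (+-identityʳ (w k)) (cong w (sym (+-identityʳ k))))
path-end o (suc t) w k x<o = trans (incidenceSum-∷-none w k (path (suc o) t _) (<⇒≢ x<o) (<⇒≢ (m<n⇒m<1+n x<o)))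
  (trans (path-end (suc o) t w (suc k) (m<n⇒m<1+n x<o)) (cong w (sym (+-suc k t))))

walk : ℕ → ℕ → ℕ → ℕ → List (ℕ × ℕ)
walk a o t b = (a , o) ∷ path o t b

length-walk : ∀ a o t b → length (walk a o t b) ≡ suc (suc t)
length-walk a o t b = cong suc (length-path o t b)

walk-avoid : ∀ {x a b} o t w k → x ≢ a → x ≢ b → Outside o t x → incidenceSum x w k (walk a o t b) ≡ 0
walk-avoid o t w k x≢a x≢b x∉ =
  trans (incidenceSum-∷-none w k (path o t _) x≢a (Outside⇒≢ x∉)) (path-avoid o t _ w (suc k) x≢b x∉)

walk-inner : ∀ {a b} o t d w k → a < o → b < o → d ≤ t →
  incidenceSum (o + d) w k (walk a o t b) ≡ w (k + d) + w (suc (k + d))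
walk-inner {a} {b} o t zero w k a<o b<o _ rewrite +-identityʳ o | +-identityʳ k =
  trans (incidenceSum-∷-snd o a w k (path o t b))
        (cong (w k +_) (path-start o t b w (suc k) (≢-sym (<⇒≢ b<o))))
walk-inner {a} {b} o (suc t) (suc d) w k a<o b<o (s≤s d≤t) = begin
  incidenceSum (o + suc d) w k ((a , o) ∷ walk o (suc o) t b)
    ≡⟨ incidenceSum-∷-none w k (walk o (suc o) t b) (≢-sym (<⇒≢ (<-trans a<o o<x))) (≢-sym (<⇒≢ o<x)) ⟩
  incidenceSum (o + suc d) w (suc k) (walk o (suc o) t b)
    ≡⟨ cong (λ x → incidenceSum x w (suc k) (walk o (suc o) t b)) (+-suc o d) ⟩
  incidenceSum (suc o + d) w (suc k) (walk o (suc o) t b)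
    ≡⟨ walk-inner (suc o) t d w (suc k) (n<1+n o) (m<n⇒m<1+n b<o) d≤t ⟩
  w (suc k + d) + w (suc (suc k + d))
    ≡⟨ cong (λ j → w j + w (suc j)) (sym (+-suc k d)) ⟩
  w (k + suc d) + w (suc (k + suc d)) ∎
  where
  o<x : o < o + suc d
  o<x = m<m+n o (s≤s z≤n)
  open ≡-Reasoning

walk-center : ∀ o t w k → 0 < o → incidenceSum 0 w k (walk 0 o t 0) ≡ w k + w (suc (k + t))
walk-center o t w k 0<o = trans (incidenceSum-∷-fst 0 o w k (path o t 0))
  (cong (w k +_) (path-end o t w (suc k) 0<o))

pathEdges-++ : ∀ o t b → pathEdges o t ++ [ (o + t , b) ] ≡ path o t b
pathEdges-++ o zero    b = cong (λ v → [ (v , b) ]) (+-identityʳ o)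
pathEdges-++ o (suc t) b = cong ((o , suc o) ∷_)
  (trans (cong (λ v → pathEdges (suc o) t ++ [ (v , b) ]) (+-suc o t)) (pathEdges-++ (suc o) t b))

cycleEdges≡walk : ∀ o t → cycleEdges o (suc (suc t)) ≡ walk 0 o t 0
cycleEdges≡walk o t = cong ((0 , o) ∷_) (pathEdges-++ o t 0)

noncentralCount : List ℕ → ℕ
noncentralCount Ls = sum (map (λ L → L ∸ 1) Ls)

spiderEdges-∷ : ∀ o t Ls → spiderEdges o (suc (suc t) ∷ Ls) ≡ walk 0 o t 0 ++ spiderEdges (o + suc t) Ls
spiderEdges-∷ o t Ls = cong (_++ spiderEdges (o + suc t) Ls) (cycleEdges≡walk o t)

length-spiderEdges-∷ : ∀ o t Ls →
  length (spiderEdges o (suc (suc t) ∷ Ls)) ≡ suc (suc t) + length (spiderEdges (o + suc t) Ls)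
length-spiderEdges-∷ o t Ls = begin
  length (spiderEdges o (suc (suc t) ∷ Ls))            ≡⟨ cong length (spiderEdges-∷ o t Ls) ⟩
  length (walk 0 o t 0 ++ rest)                        ≡⟨ length-++ (walk 0 o t 0) ⟩
  length (walk 0 o t 0) + length rest                  ≡⟨ cong (_+ length rest) (length-walk 0 o t 0) ⟩
  suc (suc t) + length rest                            ∎
  where
  rest = spiderEdges (o + suc t) Ls
  open ≡-Reasoning

incidenceSum-spiderEdges-∷ : ∀ x w k o t Ls →
  incidenceSum x w k (spiderEdges o (suc (suc t) ∷ Ls))
    ≡ incidenceSum x w k (walk 0 o t 0) + incidenceSum x w (k + suc (suc t)) (spiderEdges (o + suc t) Ls)
incidenceSum-spiderEdges-∷ x w k o t Ls = begin
  incidenceSum x w k (spiderEdges o (suc (suc t) ∷ Ls))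
    ≡⟨ cong (incidenceSum x w k) (spiderEdges-∷ o t Ls) ⟩
  incidenceSum x w k (walk 0 o t 0 ++ spiderEdges (o + suc t) Ls)
    ≡⟨ incidenceSum-++ x w k (walk 0 o t 0) _ ⟩
  incidenceSum x w k (walk 0 o t 0) + incidenceSum x w (k + length (walk 0 o t 0)) (spiderEdges (o + suc t) Ls)
    ≡⟨ cong (λ l → incidenceSum x w k (walk 0 o t 0) + incidenceSum x w (k + l) (spiderEdges (o + suc t) Ls))
            (length-walk 0 o t 0) ⟩
  incidenceSum x w k (walk 0 o t 0) + incidenceSum x w (k + suc (suc t)) (spiderEdges (o + suc t) Ls) ∎
  where open ≡-Reasoning

spider-before : ∀ {x} Ls → All (2 ≤_) Ls → ∀ o w k → x ≢ 0 → x < o →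
  incidenceSum x w k (spiderEdges o Ls) ≡ 0
spider-before [] [] o w k x≢0 x<o = refl
spider-before {x} (_ ∷ Ls) (s≤s (s≤s (z≤n {t})) ∷ Ls≥2) o w k x≢0 x<o = begin
  incidenceSum x w k (spiderEdges o (suc (suc t) ∷ Ls))
    ≡⟨ incidenceSum-spiderEdges-∷ x w k o t Ls ⟩
  incidenceSum x w k (walk 0 o t 0) + incidenceSum x w (k + suc (suc t)) (spiderEdges (o + suc t) Ls)
    ≡⟨ cong₂ _+_ (walk-avoid o t w k x≢0 x≢0 (inj₁ x<o))
                 (spider-before Ls Ls≥2 (o + suc t) w _ x≢0 (<-≤-trans x<o (m≤m+n o (suc t)))) ⟩
  0 ∎
  where open ≡-Reasoning

-- The index in spiderEdges o Ls of the first of the two edges at a non-central vertex x.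
position : ℕ → List ℕ → ℕ → ℕ
position o []       x = 0
position o (L ∷ Ls) x with x <? o + (L ∸ 1)
... | yes _ = x ∸ o
... | no _  = L + position (o + (L ∸ 1)) Ls x

spider-noncentral : ∀ {x} Ls → All (2 ≤_) Ls → ∀ o w k → 0 < o → o ≤ x → x < o + noncentralCount Ls →
  incidenceSum x w k (spiderEdges o Ls) ≡ w (k + position o Ls x) + w (suc (k + position o Ls x))
spider-noncentral {x} [] [] o w k 0<o o≤x x<o+0 = contradiction (subst (x <_) (+-identityʳ o) x<o+0) (≤⇒≯ o≤x)
spider-noncentral {x} (_ ∷ Ls) (s≤s (s≤s (z≤n {t})) ∷ Ls≥2) o w k 0<o o≤x x<end with x <? o + suc t
... | yes x<o+1+t = begin
  incidenceSum x w k (spiderEdges o (suc (suc t) ∷ Ls))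
    ≡⟨ incidenceSum-spiderEdges-∷ x w k o t Ls ⟩
  incidenceSum x w k (walk 0 o t 0) + incidenceSum x w (k + suc (suc t)) (spiderEdges (o + suc t) Ls)
    ≡⟨ cong₂ _+_ inner (spider-before Ls Ls≥2 (o + suc t) w _ x≢0 x<o+1+t) ⟩
  w (k + d) + w (suc (k + d)) + 0
    ≡⟨ +-identityʳ _ ⟩
  w (k + d) + w (suc (k + d)) ∎
  where
  d = x ∸ o
  x≢0 = n>0⇒n≢0 (<-≤-trans 0<o o≤x)
  inner : incidenceSum x w k (walk 0 o t 0) ≡ w (k + d) + w (suc (k + d))
  inner = subst (λ v → incidenceSum v w k (walk 0 o t 0) ≡ w (k + d) + w (suc (k + d))) (m+[n∸m]≡n o≤x)
    (walk-inner o t d w k 0<o 0<o (s≤s⁻¹ (m<n+o⇒m∸n<o x o x<o+1+t)))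
  open ≡-Reasoning
... | no x≮o+1+t = begin
  incidenceSum x w k (spiderEdges o (suc (suc t) ∷ Ls))
    ≡⟨ incidenceSum-spiderEdges-∷ x w k o t Ls ⟩
  incidenceSum x w k (walk 0 o t 0) + incidenceSum x w (k + suc (suc t)) (spiderEdges (o + suc t) Ls)
    ≡⟨ cong₂ _+_ (walk-avoid o t w k x≢0 x≢0 (inj₂ o+t<x))
                 (spider-noncentral Ls Ls≥2 (o + suc t) w (k + suc (suc t)) (<-≤-trans 0<o (m≤m+n o (suc t)))
                    (≮⇒≥ x≮o+1+t) (subst (x <_) (sym (+-assoc o (suc t) _)) x<end)) ⟩
  w (k + suc (suc t) + p) + w (suc (k + suc (suc t) + p))
    ≡⟨ cong (λ j → w j + w (suc j)) (+-assoc k (suc (suc t)) p) ⟩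
  w (k + (suc (suc t) + p)) + w (suc (k + (suc (suc t) + p))) ∎
  where
  p = position (o + suc t) Ls x
  x≢0 = n>0⇒n≢0 (<-≤-trans 0<o o≤x)
  o+t<x : o + t < x
  o+t<x = subst (_≤ x) (+-suc o t) (≮⇒≥ x≮o+1+t)
  open ≡-Reasoning

position-bound : ∀ {x} Ls → All (2 ≤_) Ls → ∀ o → o ≤ x → x < o + noncentralCount Ls →
  suc (suc (position o Ls x)) ≤ length (spiderEdges o Ls)
position-bound {x} [] [] o o≤x x<o+0 = contradiction (subst (x <_) (+-identityʳ o) x<o+0) (≤⇒≯ o≤x)
position-bound {x} (_ ∷ Ls) (s≤s (s≤s (z≤n {t})) ∷ Ls≥2) o o≤x x<end with x <? o + suc t
... | yes x<o+1+t = begin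
  suc (suc (x ∸ o))                                  ≤⟨ s≤s (m<n+o⇒m∸n<o x o x<o+1+t) ⟩
  suc (suc t)                                        ≤⟨ m≤m+n (suc (suc t)) _ ⟩
  suc (suc t) + length (spiderEdges (o + suc t) Ls)  ≡⟨ length-spiderEdges-∷ o t Ls ⟨
  length (spiderEdges o (suc (suc t) ∷ Ls))          ∎
  where open ≤-Reasoning
... | no x≮o+1+t = begin
  suc (suc (suc (suc t) + p))                        ≡⟨ +-suc-suc (suc (suc t)) p ⟨
  suc (suc t) + suc (suc p)                          ≤⟨ +-monoʳ-≤ (suc (suc t)) rest-bound ⟩
  suc (suc t) + length (spiderEdges (o + suc t) Ls)  ≡⟨ length-spiderEdges-∷ o t Ls ⟨
  length (spiderEdges o (suc (suc t) ∷ Ls))          ∎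
  where
  p = position (o + suc t) Ls x
  rest-bound : suc (suc p) ≤ length (spiderEdges (o + suc t) Ls)
  rest-bound = position-bound Ls Ls≥2 (o + suc t) (≮⇒≥ x≮o+1+t) (subst (x <_) (sym (+-assoc o (suc t) _)) x<end)
  open ≤-Reasoning

position-strict : ∀ {x y} Ls → All (2 ≤_) Ls → ∀ o → o ≤ x → x < y → y < o + noncentralCount Ls →
  position o Ls x < position o Ls y
position-strict {x} {y} [] [] o o≤x x<y y<o+0 =
  contradiction (subst (y <_) (+-identityʳ o) y<o+0) (≤⇒≯ (≤-trans o≤x (<⇒≤ x<y)))
position-strict {x} {y} (_ ∷ Ls) (s≤s (s≤s (z≤n {t})) ∷ Ls≥2) o o≤x x<y y<end
  with x <? o + suc t | y <? o + suc t
... | yes _           | yes _      = ∸-monoˡ-< x<y o≤x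
... | yes x<o+1+t     | no _       = <-≤-trans (m<n+o⇒m∸n<o x o x<o+1+t)
                                      (≤-trans (n≤1+n (suc t)) (m≤m+n (suc (suc t)) _))
... | no x≮o+1+t      | yes y<o+1+t = contradiction (<-trans x<y y<o+1+t) x≮o+1+t
... | no x≮o+1+t      | no _       = +-monoʳ-< (suc (suc t)) (position-strict Ls Ls≥2 (o + suc t)
                                      (≮⇒≥ x≮o+1+t) x<y (subst (y <_) (sym (+-assoc o (suc t) _)) y<end))

spider-center-∷ : ∀ o t Ls w k → 0 < o →
  incidenceSum 0 w k (spiderEdges o (suc (suc t) ∷ Ls))
    ≡ (w k + w (suc (k + t))) + incidenceSum 0 w (k + suc (suc t)) (spiderEdges (o + suc t) Ls)
spider-center-∷ o t Ls w k 0<o = trans (incidenceSum-spiderEdges-∷ 0 w k o t Ls)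
  (cong (_+ incidenceSum 0 w (k + suc (suc t)) (spiderEdges (o + suc t) Ls)) (walk-center o t w k 0<o))

center-lower-bound : ∀ Ls → All (2 ≤_) Ls → 3 ≤ length Ls → ∀ w →
  ∃₂ λ i j → w 0 + (w i + w (suc i)) + (w j + w (suc j)) ≤ incidenceSum 0 w 0 (spiderEdges 1 Ls)
center-lower-bound (_ ∷ [])     _ (s≤s ())
center-lower-bound (_ ∷ _ ∷ []) _ (s≤s (s≤s ()))
center-lower-bound (_ ∷ _ ∷ _ ∷ Ls)
  (s≤s (s≤s (z≤n {t₁})) ∷ s≤s (s≤s (z≤n {t₂})) ∷ s≤s (s≤s (z≤n {t₃})) ∷ _) _ w =
  suc t₁ , suc (k₁ + t₂) , (begin
    w 0 + (w (suc t₁) + w k₁) + (w (suc (k₁ + t₂)) + w (suc (suc (k₁ + t₂))))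
      ≡⟨ cong (λ v → w 0 + (w (suc t₁) + w k₁) + (w (suc (k₁ + t₂)) + w v)) (+-suc-suc k₁ t₂) ⟨
    w 0 + (w (suc t₁) + w k₁) + (w (suc (k₁ + t₂)) + w k₂)
      ≡⟨ cong (_+ (w (suc (k₁ + t₂)) + w k₂)) (+-assoc (w 0) (w (suc t₁)) (w k₁)) ⟨
    w 0 + w (suc t₁) + w k₁ + (w (suc (k₁ + t₂)) + w k₂)
      ≡⟨ +-assoc (w 0 + w (suc t₁)) (w k₁) _ ⟩
    w 0 + w (suc t₁) + (w k₁ + (w (suc (k₁ + t₂)) + w k₂))
      ≡⟨ cong (w 0 + w (suc t₁) +_) (+-assoc (w k₁) (w (suc (k₁ + t₂))) (w k₂)) ⟨
    w 0 + w (suc t₁) + (w k₁ + w (suc (k₁ + t₂)) + w k₂)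
      ≤⟨ +-monoʳ-≤ (w 0 + w (suc t₁)) (+-monoʳ-≤ (w k₁ + w (suc (k₁ + t₂))) third) ⟩
    w 0 + w (suc t₁) + (w k₁ + w (suc (k₁ + t₂)) + incidenceSum 0 w k₂ (spiderEdges o₂ (suc (suc t₃) ∷ Ls)))
      ≡⟨ cong (w 0 + w (suc t₁) +_) (spider-center-∷ k₁ t₂ (suc (suc t₃) ∷ Ls) w k₁ z<s) ⟨
    w 0 + w (suc t₁) + incidenceSum 0 w k₁ (spiderEdges k₁ (suc (suc t₂) ∷ suc (suc t₃) ∷ Ls))
      ≡⟨ spider-center-∷ 1 t₁ (suc (suc t₂) ∷ suc (suc t₃) ∷ Ls) w 0 z<s ⟨
    incidenceSum 0 w 0 (spiderEdges 1 (suc (suc t₁) ∷ suc (suc t₂) ∷ suc (suc t₃) ∷ Ls)) ∎)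
  where
  k₁ = suc (suc t₁)
  k₂ = k₁ + suc (suc t₂)
  o₂ = k₁ + suc t₂
  third : w k₂ ≤ incidenceSum 0 w k₂ (spiderEdges o₂ (suc (suc t₃) ∷ Ls))
  third = ≤-trans (≤-trans (m≤m+n (w k₂) _) (m≤m+n _ _)) (≤-reflexive (sym (spider-center-∷ o₂ t₃ Ls w k₂ z<s)))
  open ≤-Reasoning

antimagic-if-center-dominates : ∀ {N} (s d : Fin (suc N) → ℕ) →
  (∀ {x y} → x Fin.< y → s (fsuc x) < s (fsuc y)) →
  (∀ x → s (fsuc x) < s fzero) →
  (∀ x → d (fsuc x) ≡ 2) → 2 ≤ d fzero →
  (∀ x y → x ≢ y → s x ≢ s y) × (∀ x y → d y < d x → s y < s x)
antimagic-if-center-dominates s d s-increasing s-center d-noncentral d-center = distinct , monotone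
  where
  distinct : ∀ x y → x ≢ y → s x ≢ s y
  distinct fzero    fzero    x≢y _  = x≢y refl
  distinct fzero    (fsuc y) _   eq = <⇒≢ (s-center y) (sym eq)
  distinct (fsuc x) fzero    _   eq = <⇒≢ (s-center x) eq
  distinct (fsuc x) (fsuc y) x≢y eq with Fin.<-cmp x y
  ... | tri< x<y _ _ = <⇒≢ (s-increasing x<y) eq
  ... | tri≈ _ x≡y _ = x≢y (cong fsuc x≡y)
  ... | tri> _ _ y<x = <⇒≢ (s-increasing y<x) (sym eq)
  d≥2 : ∀ y → 2 ≤ d y
  d≥2 fzero    = d-center
  d≥2 (fsuc y) = ≤-reflexive (sym (d-noncentral y))
  monotone : ∀ x y → d y < d x → s y < s x
  monotone fzero    fzero    dy<dx = contradiction dy<dx (<-irrefl refl)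
  monotone fzero    (fsuc y) _     = s-center y
  monotone (fsuc x) y        dy<dx = contradiction (subst (d y <_) (d-noncentral x) dy<dx) (≤⇒≯ (d≥2 y))

module CycleSpider (Ls : List ℕ) (Ls≥2 : All (2 ≤_) Ls) (3≤length : 3 ≤ length Ls) where

  G = cycleSpider Ls
  M = m G
  H = ⌊ M /2⌋
  f = zigzagFin M

  weight : ℕ → ℕ
  weight j = suc (zigzag H j)

  φ≡incidenceSum : ∀ x → φ G f x ≡ incidenceSum (toℕ x) weight 0 (edges G)
  φ≡incidenceSum x =
    incidenceSum-allFin (toℕ x) (edges G) (label G f) weight (λ i → cong suc (toℕ-zigzagFin M i))

  deg≡incidenceSum : ∀ x → deg G x ≡ incidenceSum (toℕ x) (λ _ → 1) 0 (edges G)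
  deg≡incidenceSum x = incidenceSum-allFin (toℕ x) (edges G) (λ _ → 1) (λ _ → 1) (λ _ → refl)

  weight-consecutive : ∀ j → weight j + weight (suc j) ≡ suc (suc (H + j))
  weight-consecutive j = cong suc (trans (+-suc _ _) (cong suc (zigzag-consecutive H j)))

  firstEdge : Fin (noncentralCount Ls) → ℕ
  firstEdge x = position 1 Ls (suc (toℕ x))

  incidenceSum-noncentral : ∀ w x →
    incidenceSum (suc (toℕ x)) w 0 (edges G) ≡ w (firstEdge x) + w (suc (firstEdge x))
  incidenceSum-noncentral w x = spider-noncentral Ls Ls≥2 1 w 0 z<s (s≤s z≤n) (s≤s (Fin.toℕ<n x))

  φ-noncentral : ∀ x → φ G f (fsuc x) ≡ suc (suc (H + firstEdge x))
  φ-noncentral x = trans (φ≡incidenceSum (fsuc x))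
    (trans (incidenceSum-noncentral weight x) (weight-consecutive (firstEdge x)))

  deg-noncentral : ∀ x → deg G (fsuc x) ≡ 2
  deg-noncentral x = trans (deg≡incidenceSum (fsuc x)) (incidenceSum-noncentral (λ _ → 1) x)

  φ-increasing : ∀ {x y} → x Fin.< y → φ G f (fsuc x) < φ G f (fsuc y)
  φ-increasing {x} {y} x<y rewrite φ-noncentral x | φ-noncentral y =
    s≤s (s≤s (+-monoʳ-< H (position-strict Ls Ls≥2 1 (s≤s z≤n) (s≤s x<y) (s≤s (Fin.toℕ<n y)))))

  φ-center-dominates : ∀ x → φ G f (fsuc x) < φ G f fzero
  φ-center-dominates x with center-lower-bound Ls Ls≥2 3≤length weight
  ... | i , j , bound = begin-strict
    φ G f (fsuc x)                        ≡⟨ φ-noncentral x ⟩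
    suc (suc (H + firstEdge x))           ≡⟨ +-suc-suc H (firstEdge x) ⟨
    H + suc (suc (firstEdge x))           ≤⟨ +-monoʳ-≤ H (position-bound Ls Ls≥2 1 (s≤s z≤n) (s≤s (Fin.toℕ<n x))) ⟩
    H + M                                 ≤⟨ +-monoʳ-≤ H (n≤1+⌊n/2⌋+⌊n/2⌋ M) ⟩
    H + suc (H + H)                       <⟨ m<m+n _ z<s ⟩
    H + suc (H + H) + (4 + (i + j))       ≡⟨ center-expand H i j ⟨
    suc H + suc (suc (H + i)) + suc (suc (H + j))
      ≡⟨ cong₂ (λ a b → suc H + a + b) (weight-consecutive i) (weight-consecutive j) ⟨
    weight 0 + (weight i + weight (suc i)) + (weight j + weight (suc j))
                                          ≤⟨ bound ⟩
    incidenceSum 0 weight 0 (edges G)     ≡⟨ φ≡incidenceSum fzero ⟨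
    φ G f fzero                           ∎
    where
    open ≤-Reasoning
    center-expand : ∀ H i j → suc H + suc (suc (H + i)) + suc (suc (H + j)) ≡ H + suc (H + H) + (4 + (i + j))
    center-expand = solve-∀

  deg-center : 2 ≤ deg G fzero
  deg-center with center-lower-bound Ls Ls≥2 3≤length (λ _ → 1)
  ... | _ , _ , bound = ≤-trans (s≤s (s≤s z≤n)) (≤-trans bound (≤-reflexive (sym (deg≡incidenceSum fzero))))

  stronglyAntimagic : StronglyAntimagic G
  stronglyAntimagic = f , zigzagFin-bijective M ,
    antimagic-if-center-dominates (φ G f) (deg G) φ-increasing φ-center-dominates deg-noncentral deg-center

corollary3p3 : (Ls : List ℕ) → 3 ≤ length Ls → All (3 ≤_) Ls → StronglyAntimagic (cycleSpider Ls)
corollary3p3 Ls 3≤length Ls≥3 = CycleSpider.stronglyAntimagic Ls (All.map <⇒≤ Ls≥3) 3≤length
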